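{- The category $\mathbf{BiLat}$ is Cartesian closed.
   Context: For a complete lattice $\mathcal{L}=\langle L,\le_L\rangle$, $\mathcal{L}^{op}=\langle L,\ge_L\rangle$, and $\mathcal{L}\times\mathcal{L}^{op}$ is the square bilattice $\langle L\times L,\le_p\rangle$ with $(x_1,y_1)\le_p(x_2,y_2)$ iff $x_1\le_L x_2$ and $y_2\le_L y_1$. $\mathbf{BiLat}$ is the category whose objects are the posets $\mathcal{L}\times\mathcal{L}^{op}$ for $\mathcal{L}$ a complete lattice and whose morphisms are all monotone functions between them. A category is Cartesian closed if it has a terminal object, binary products, and exponentials. -}

module Defs where

open import Level using (Level; suc; _⊔_)
open import Data.Product using (_×_; _,_; proj₁; proj₂)
open import Relation.Binary.Core using (Rel)
open import Relation.Binary.Bundles using (Poset)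
open import Relation.Binary.Structures using (IsEquivalence)

record Category (o m e : Level) : Set (suc (o ⊔ m ⊔ e)) where
  infixr 9 _∘_
  infix  4 _≈_
  field
    Obj   : Set o
    _⇒_   : Obj → Obj → Set m
    _≈_   : ∀ {A B} → Rel (A ⇒ B) e
    id    : ∀ {A} → A ⇒ A
    _∘_   : ∀ {A B C} → B ⇒ C → A ⇒ B → A ⇒ C
    equiv : ∀ {A B} → IsEquivalence (_≈_ {A} {B})
    assoc : ∀ {A B C D} (f : A ⇒ B) (g : B ⇒ C) (h : C ⇒ D) →
            (h ∘ g) ∘ f ≈ h ∘ (g ∘ f)
    identityˡ : ∀ {A B} (f : A ⇒ B) → id ∘ f ≈ f
    identityʳ : ∀ {A B} (f : A ⇒ B) → f ∘ id ≈ f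
    ∘-resp-≈  : ∀ {A B C} {f h : B ⇒ C} {g i : A ⇒ B} →
                f ≈ h → g ≈ i → f ∘ g ≈ h ∘ i

record CartesianClosed {o m e : Level} (C : Category o m e) : Set (o ⊔ m ⊔ e) where
  open Category C
  infixr 7 _⊗_
  field
    ⊤        : Obj
    !        : ∀ {A} → A ⇒ ⊤
    !-unique : ∀ {A} (f : A ⇒ ⊤) → f ≈ !
    _⊗_       : Obj → Obj → Obj
    π₁        : ∀ {A B} → (A ⊗ B) ⇒ A
    π₂        : ∀ {A B} → (A ⊗ B) ⇒ B
    ⟨_,_⟩     : ∀ {X A B} → X ⇒ A → X ⇒ B → X ⇒ (A ⊗ B)
    π₁-⟨⟩     : ∀ {X A B} (f : X ⇒ A) (g : X ⇒ B) → π₁ ∘ ⟨ f , g ⟩ ≈ f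
    π₂-⟨⟩     : ∀ {X A B} (f : X ⇒ A) (g : X ⇒ B) → π₂ ∘ ⟨ f , g ⟩ ≈ g
    ⟨⟩-unique : ∀ {X A B} {f : X ⇒ A} {g : X ⇒ B} (h : X ⇒ (A ⊗ B)) →
                π₁ ∘ h ≈ f → π₂ ∘ h ≈ g → h ≈ ⟨ f , g ⟩
    Exp          : Obj → Obj → Obj
    eval         : ∀ {A B} → (Exp A B ⊗ A) ⇒ B
    curry        : ∀ {X A B} → (X ⊗ A) ⇒ B → X ⇒ Exp A B
    eval-curry   : ∀ {X A B} (f : (X ⊗ A) ⇒ B) →
                   eval ∘ ⟨ curry f ∘ π₁ , π₂ ⟩ ≈ f
    curry-unique : ∀ {X A B} {f : (X ⊗ A) ⇒ B} (h : X ⇒ Exp A B) →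
                   eval ∘ ⟨ h ∘ π₁ , π₂ ⟩ ≈ f → h ≈ curry f

record CompleteLattice (ℓ : Level) : Set (suc ℓ) where
  field
    poset : Poset ℓ ℓ ℓ
  open Poset poset public
  field
    ⋁       : {I : Set ℓ} → (I → Carrier) → Carrier
    ⋁-upper : ∀ {I : Set ℓ} (f : I → Carrier) (i : I) → f i ≤ ⋁ f
    ⋁-least : ∀ {I : Set ℓ} (f : I → Carrier) (x : Carrier) →
              (∀ i → f i ≤ x) → ⋁ f ≤ x
    ⋀       : {I : Set ℓ} → (I → Carrier) → Carrier
    ⋀-lower : ∀ {I : Set ℓ} (f : I → Carrier) (i : I) → ⋀ f ≤ f i
    ⋀-great : ∀ {I : Set ℓ} (f : I → Carrier) (x : Carrier) →
              (∀ i → x ≤ f i) → x ≤ ⋀ f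

module Square {ℓ : Level} (L : CompleteLattice ℓ) where
  open CompleteLattice L

  Carrier² : Set ℓ
  Carrier² = Carrier × Carrier

  _≤p_ : Rel Carrier² ℓ
  (x₁ , y₁) ≤p (x₂ , y₂) = (x₁ ≤ x₂) × (y₂ ≤ y₁)

  _≈p_ : Rel Carrier² ℓ
  (x₁ , y₁) ≈p (x₂ , y₂) = (x₁ ≈ x₂) × (y₁ ≈ y₂)

record Mono {ℓ : Level} (L M : CompleteLattice ℓ) : Set ℓ where
  private
    module SL = Square L
    module SM = Square M
  field
    fun  : SL.Carrier² → SM.Carrier²
    mono : ∀ {p q} → p SL.≤p q → fun p SM.≤p fun q
open Mono public

_≈ₘ_ : ∀ {ℓ} {L M : CompleteLattice ℓ} → Rel (Mono L M) ℓ
_≈ₘ_ {M = M} f g = ∀ p → fun f p ≈p fun g p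
  where open Square M

private
  module _ {ℓ : Level} where
    idₘ : {L : CompleteLattice ℓ} → Mono L L
    idₘ = record { fun = λ p → p ; mono = λ le → le }

    _∘ₘ_ : {L M N : CompleteLattice ℓ} → Mono M N → Mono L M → Mono L N
    f ∘ₘ g = record { fun = λ p → fun f (fun g p) ; mono = λ le → mono f (mono g le) }

    ≈p-refl : (L : CompleteLattice ℓ) → ∀ {p} → Square._≈p_ L p p
    ≈p-refl L = Eq.refl , Eq.refl where open CompleteLattice L

    ≈p-sym : (L : CompleteLattice ℓ) → ∀ {p q} → Square._≈p_ L p q → Square._≈p_ L q p
    ≈p-sym L (a , b) = Eq.sym a , Eq.sym b where open CompleteLattice L

    ≈p-trans : (L : CompleteLattice ℓ) → ∀ {p q r} →
               Square._≈p_ L p q → Square._≈p_ L q r → Square._≈p_ L p r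
    ≈p-trans L (a , b) (c , d) = Eq.trans a c , Eq.trans b d
      where open CompleteLattice L

    mono-resp : {L M : CompleteLattice ℓ} (f : Mono L M) → ∀ {p q} →
                Square._≈p_ L p q → Square._≈p_ M (fun f p) (fun f q)
    mono-resp {L} {M} f (a , b) with mono f (L.reflexive a , L.reflexive (L.Eq.sym b))
                                   | mono f (L.reflexive (L.Eq.sym a) , L.reflexive b)
      where module L = CompleteLattice L
    ... | (u , v) | (w , z) = M.antisym u w , M.antisym z v
      where module M = CompleteLattice M

-- The category BiLat (at universe level ℓ): objects are the square
-- bilattices L × L^op (indexed by the complete lattice L), morphisms are
-- all monotone maps between them.
BiLat : (ℓ : Level) → Category (suc ℓ) ℓ ℓ
BiLat ℓ = record
  { Obj   = CompleteLattice ℓ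
  ; _⇒_   = Mono
  ; _≈_   = _≈ₘ_
  ; id    = idₘ
  ; _∘_   = _∘ₘ_
  ; equiv = λ {A} {B} → record
      { refl  = λ p → ≈p-refl B
      ; sym   = λ e p → ≈p-sym B (e p)
      ; trans = λ e₁ e₂ p → ≈p-trans B (e₁ p) (e₂ p) }
  ; assoc     = λ {A} {B} {C} {D} f g h p → ≈p-refl D
  ; identityˡ = λ {A} {B} f p → ≈p-refl B
  ; identityʳ = λ {A} {B} f p → ≈p-refl B
  ; ∘-resp-≈  = λ {A} {B} {C} {f} {h} {g} {i} e₁ e₂ p →
      ≈p-trans C (mono-resp f (e₂ p)) (e₁ (fun i p))
  }

-- A monotone map L × L^op → M × M^op is the same as a pair of monotone maps
-- L × L^op → M: the first component, and the second one read through the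
-- swap (L × L^op)^op ≅ L × L^op.  Hence BiLat inherits its terminal object and
-- products from complete lattices, and the exponential of L and M is the
-- square bilattice of the complete lattice of monotone maps L × L^op → M,
-- ordered pointwise; currying and evaluation act on both components alike.
module Submission where

open import Defs
open import Level using (Level)
open import Data.Product using (_×_; _,_; proj₁; proj₂; swap)
open import Data.Unit.Polymorphic using (⊤; tt)

module _ {ℓ : Level} where

  ⊤ᴸ : CompleteLattice ℓ
  ⊤ᴸ = record
    { poset = record
        { Carrier = ⊤ ; _≈_ = λ _ _ → ⊤ ; _≤_ = λ _ _ → ⊤
        ; isPartialOrder = record
            { isPreorder = record
                { isEquivalence = record { refl = tt ; sym = λ _ → tt ; trans = λ _ _ → tt }
                ; reflexive = λ _ → tt ; trans = λ _ _ → tt }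
            ; antisym = λ _ _ → tt } }
    ; ⋁ = λ _ → tt ; ⋁-upper = λ _ _ → tt ; ⋁-least = λ _ _ _ → tt
    ; ⋀ = λ _ → tt ; ⋀-lower = λ _ _ → tt ; ⋀-great = λ _ _ _ → tt }

  infixr 7 _×ᴸ_
  _×ᴸ_ : CompleteLattice ℓ → CompleteLattice ℓ → CompleteLattice ℓ
  L ×ᴸ M = record
    { poset = record
        { Carrier = L.Carrier × M.Carrier
        ; _≈_ = λ (x , y) (x′ , y′) → (x L.≈ x′) × (y M.≈ y′)
        ; _≤_ = λ (x , y) (x′ , y′) → (x L.≤ x′) × (y M.≤ y′)
        ; isPartialOrder = record
            { isPreorder = record
                { isEquivalence = record
                    { refl  = L.Eq.refl , M.Eq.refl
                    ; sym   = λ (a , b) → L.Eq.sym a , M.Eq.sym b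
                    ; trans = λ (a , b) (c , d) → L.Eq.trans a c , M.Eq.trans b d }
                ; reflexive = λ (a , b) → L.reflexive a , M.reflexive b
                ; trans     = λ (a , b) (c , d) → L.trans a c , M.trans b d }
            ; antisym = λ (a , b) (c , d) → L.antisym a c , M.antisym b d } }
    ; ⋁       = λ f → L.⋁ (λ i → proj₁ (f i)) , M.⋁ (λ i → proj₂ (f i))
    ; ⋁-upper = λ f i → L.⋁-upper _ i , M.⋁-upper _ i
    ; ⋁-least = λ f x h → L.⋁-least _ _ (λ i → proj₁ (h i)) , M.⋁-least _ _ (λ i → proj₂ (h i))
    ; ⋀       = λ f → L.⋀ (λ i → proj₁ (f i)) , M.⋀ (λ i → proj₂ (f i))
    ; ⋀-lower = λ f i → L.⋀-lower _ i , M.⋀-lower _ i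
    ; ⋀-great = λ f x h → L.⋀-great _ _ (λ i → proj₁ (h i)) , M.⋀-great _ _ (λ i → proj₂ (h i))
    }
    where
      module L = CompleteLattice L
      module M = CompleteLattice M

  record Monotone (L M : CompleteLattice ℓ) : Set ℓ where
    private
      module L = Square L
      module M = CompleteLattice M
    field
      app      : L.Carrier² → M.Carrier
      app-mono : ∀ {p q} → p L.≤p q → app p M.≤ app q
  open Monotone

  infixr 6 _⇒ᴸ_
  _⇒ᴸ_ : CompleteLattice ℓ → CompleteLattice ℓ → CompleteLattice ℓ
  L ⇒ᴸ M = record
    { poset = record
        { Carrier = Monotone L M
        ; _≈_ = λ f g → ∀ p → app f p M.≈ app g p
        ; _≤_ = λ f g → ∀ p → app f p M.≤ app g p
        ; isPartialOrder = record
            { isPreorder = record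
                { isEquivalence = record
                    { refl  = λ p → M.Eq.refl
                    ; sym   = λ e p → M.Eq.sym (e p)
                    ; trans = λ e e′ p → M.Eq.trans (e p) (e′ p) }
                ; reflexive = λ e p → M.reflexive (e p)
                ; trans     = λ e e′ p → M.trans (e p) (e′ p) }
            ; antisym = λ e e′ p → M.antisym (e p) (e′ p) } }
    ; ⋁       = λ F → record
        { app      = λ p → M.⋁ (λ i → app (F i) p)
        ; app-mono = λ {p} {q} le → M.⋁-least _ _ λ i →
            M.trans (app-mono (F i) le) (M.⋁-upper (λ j → app (F j) q) i) }
    ; ⋁-upper = λ F i p → M.⋁-upper (λ j → app (F j) p) i
    ; ⋁-least = λ F x h p → M.⋁-least _ _ (λ i → h i p)
    ; ⋀       = λ F → record
        { app      = λ p → M.⋀ (λ i → app (F i) p)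
        ; app-mono = λ {p} {q} le → M.⋀-great _ _ λ i →
            M.trans (M.⋀-lower (λ j → app (F j) p) i) (app-mono (F i) le) }
    ; ⋀-lower = λ F i p → M.⋀-lower (λ j → app (F j) p) i
    ; ⋀-great = λ F x h p → M.⋀-great _ _ (λ i → h i p)
    }
    where module M = CompleteLattice M

  module _ {L M : CompleteLattice ℓ} where

    first : Mono L M → Monotone L M
    first h = record
      { app      = λ p → proj₁ (fun h p)
      ; app-mono = λ le → proj₁ (mono h le) }

    second : Mono L M → Monotone L M
    second h = record
      { app      = λ p → proj₂ (fun h (swap p))
      ; app-mono = λ (u , v) → proj₂ (mono h (v , u)) }

    split : Monotone L M → Monotone L M → Mono L M
    split f g = record
      { fun  = λ p → app f p , app g (swap p)
      ; mono = λ (u , v) → app-mono f (u , v) , app-mono g (v , u) }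

  module _ {X A B : CompleteLattice ℓ} where

    private
      module X = CompleteLattice X
      module A = CompleteLattice A

    pairᴹ : Monotone X A → Monotone X B → Monotone X (A ×ᴸ B)
    pairᴹ f g = record
      { app      = λ p → app f p , app g p
      ; app-mono = λ le → app-mono f le , app-mono g le }

    curryᴹ : Monotone (X ×ᴸ A) B → Monotone X (A ⇒ᴸ B)
    curryᴹ h = record
      { app      = λ (x , y) → record
          { app      = λ (a , a′) → app h ((x , a) , (y , a′))
          ; app-mono = λ (u , v) → app-mono h ((X.refl , u) , (X.refl , v)) }
      ; app-mono = λ (u , v) (a , a′) → app-mono h ((u , A.refl) , (v , A.refl)) }

  module _ {A B : CompleteLattice ℓ} where

    outlᴹ : Monotone (A ×ᴸ B) A
    outlᴹ = record
      { app      = λ ((a , _) , _) → a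
      ; app-mono = λ ((u , _) , _) → u }

    outrᴹ : Monotone (A ×ᴸ B) B
    outrᴹ = record
      { app      = λ ((_ , b) , _) → b
      ; app-mono = λ ((_ , u) , _) → u }

    evalᴹ : Monotone ((A ⇒ᴸ B) ×ᴸ A) B
    evalᴹ = record
      { app      = λ ((f , a) , (_ , a′)) → app f (a , a′)
      ; app-mono = λ { {(f , a) , _} {(_ , a₂) , (_ , a₂′)} ((f≤ , u) , (_ , v)) →
          CompleteLattice.trans B (app-mono f (u , v)) (f≤ (a₂ , a₂′)) } }

  open Category (BiLat ℓ) using (_∘_)

  module _ {A B : CompleteLattice ℓ} where

    π₁ : Mono (A ×ᴸ B) A
    π₁ = split (outlᴹ {A} {B}) (outlᴹ {A} {B})

    π₂ : Mono (A ×ᴸ B) B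
    π₂ = split (outrᴹ {A} {B}) (outrᴹ {A} {B})

    eval : Mono ((A ⇒ᴸ B) ×ᴸ A) B
    eval = split (evalᴹ {A} {B}) (evalᴹ {A} {B})

  ⟨_,_⟩ : {X A B : CompleteLattice ℓ} → Mono X A → Mono X B → Mono X (A ×ᴸ B)
  ⟨ f , g ⟩ = split (pairᴹ (first f) (first g)) (pairᴹ (second f) (second g))

  curry : {X A B : CompleteLattice ℓ} → Mono (X ×ᴸ A) B → Mono X (A ⇒ᴸ B)
  curry h = split (curryᴹ (first h)) (curryᴹ (second h))

  curry-unique : {X A B : CompleteLattice ℓ} {f : Mono (X ×ᴸ A) B} (k : Mono X (A ⇒ᴸ B)) →
                 (eval ∘ ⟨ k ∘ π₁ {X} {A} , π₂ {X} {A} ⟩) ≈ₘ f → k ≈ₘ curry f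
  curry-unique k e (x , y) = (λ (a , a′) → proj₁ (e ((x , a) , (y , a′))))
                           , (λ (b , b′) → proj₂ (e ((x , b′) , (y , b))))

  ≈p-refl : (L : CompleteLattice ℓ) → ∀ {p} → Square._≈p_ L p p
  ≈p-refl L = Eq.refl , Eq.refl where open CompleteLattice L

theorem2 : (ℓ : Level) → CartesianClosed (BiLat ℓ)
theorem2 ℓ = record
  { ⊤            = ⊤ᴸ
  ; !            = record { fun = λ _ → tt , tt ; mono = λ _ → tt , tt }
  ; !-unique     = λ f p → tt , tt
  ; _⊗_          = _×ᴸ_
  ; π₁           = λ {A} {B} → π₁ {A = A} {B}
  ; π₂           = λ {A} {B} → π₂ {A = A} {B}
  ; ⟨_,_⟩        = ⟨_,_⟩
  ; π₁-⟨⟩        = λ {_} {A} f g p → ≈p-refl A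
  ; π₂-⟨⟩        = λ {_} {_} {B} f g p → ≈p-refl B
  ; ⟨⟩-unique    = λ h e₁ e₂ p → (proj₁ (e₁ p) , proj₁ (e₂ p)) , (proj₂ (e₁ p) , proj₂ (e₂ p))
  ; Exp          = _⇒ᴸ_
  ; eval         = eval
  ; curry        = curry
  ; eval-curry   = λ {_} {_} {B} f p → ≈p-refl B
  ; curry-unique = λ {X} {A} {B} {f} → curry-unique {X = X} {A} {B} {f}
  }
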